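{- A finite graph $G$ is a Blanche Descartes graph if and only if every induced subgraph of $G$ contains a non-empty strongly splitting stable set.
   Context: Blanche Descartes construction: $D_1$ is the one-vertex graph; if $D_k$ has been constructed and has $n$ vertices, $D_{k+1}$ is obtained by taking a stable set $S$ of $k(n-1)+1$ new vertices and, for each $n$-element subset $T$ of $S$, adding a new copy of $D_k$ together with a perfect matching between $T$ and the vertices of that copy (the matchings may be chosen arbitrarily). A Blanche Descartes graph is any graph isomorphic to an induced subgraph of some graph obtained after $k$ steps of this construction, for some $k\ge 1$. A stable set $S$ of a graph $G$ is strongly splitting if every vertex of $S$ has at most one neighbor in each connected component of $G\setminus S$, and every vertex of $G\setminus S$ has at most one neighbor in $S$. Induced subgraphs are taken on non-empty vertex sets. -}

module Defs where

open import Level using (0ℓ)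
open import Data.Nat using (ℕ; zero; suc; _+_; _*_; _∸_)
open import Data.Fin using (Fin)
import Data.Fin as F
open import Data.Fin.Subset using (Subset; _∈_; ∣_∣)
open import Data.Bool using (Bool; true; false; _∧_)
import Data.Bool as B
open import Data.Sum using (_⊎_; inj₁; inj₂)
open import Data.Product using (Σ; ∃; _×_; _,_; proj₁)
open import Data.Vec.Properties using (≡-dec)
open import Relation.Nullary using (¬_)
open import Relation.Nullary.Decidable using (⌊_⌋)
open import Relation.Binary.PropositionalEquality using (_≡_)
open import Relation.Binary.Construct.Closure.ReflexiveTransitive using (Star)
open import Relation.Unary using (Pred)
open import Function.Bundles using (_↔_; Inverse)
open import Function.Definitions using (Injective)

record Graph (V : Set) : Set where
  constructor mkGraph
  field adj : V → V → Bool
open Graph public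

IsSimple : ∀ {V} → Graph V → Set
IsSimple G = (∀ u v → adj G u v ≡ adj G v u) × (∀ v → adj G v v ≡ false)

induced : ∀ {V} → Graph V → (P : Pred V 0ℓ) → Graph (Σ V P)
induced G P = mkGraph (λ x y → adj G (proj₁ x) (proj₁ y))

_[_] : ∀ {n} → Graph (Fin n) → (X : Subset n) → Graph (Σ (Fin n) (λ v → v ∈ X))
G [ X ] = induced G (λ v → v ∈ X)

Iso : ∀ {V W} → Graph V → Graph W → Set
Iso {V} {W} G H = Σ (V ↔ W) λ φ →
  ∀ x y → adj G x y ≡ adj H (Inverse.to φ x) (Inverse.to φ y)

InducedEmbedding : ∀ {V W} → Graph V → Graph W → Set
InducedEmbedding {V} {W} G H = Σ (V → W) λ f →
  Injective _≡_ _≡_ f × (∀ x y → adj G x y ≡ adj H (f x) (f y))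

-- From D_k (here D, on n vertices), build D_{k+1}: a stable set S of
-- k(n-1)+1 new vertices, and for every n-element subset T of S a new copy
-- of D_k with a perfect matching between T and that copy.

module Step (k : ℕ) {n : ℕ} (D : Graph (Fin n)) where

  sz : ℕ
  sz = k * (n ∸ 1) + 1

  Copies : Set
  Copies = Σ (Subset sz) (λ T → ∣ T ∣ ≡ n)

  -- vertices of D_{k+1}: the stable set S, plus (T , v) = vertex v of the copy for T
  StepV : Set
  StepV = Fin sz ⊎ (Copies × Fin n)

  record Matching : Set where
    field
      μ    : Copies → Fin n → Fin sz
      inj  : ∀ c {v w} → μ c v ≡ μ c w → v ≡ w
      into : ∀ c v → μ c v ∈ proj₁ c
      onto : ∀ c i → i ∈ proj₁ c → ∃ λ v → μ c v ≡ i

  stepGraph : Matching → Graph StepV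
  stepGraph M = mkGraph a
    where
    open Matching M
    a : StepV → StepV → Bool
    a (inj₁ s) (inj₁ t) = false
    a (inj₁ s) (inj₂ (c , v)) = ⌊ μ c v F.≟ s ⌋
    a (inj₂ (c , v)) (inj₁ s) = ⌊ μ c v F.≟ s ⌋
    a (inj₂ (c , v)) (inj₂ (d , w)) = ⌊ ≡-dec B._≟_ (proj₁ c) (proj₁ d) ⌋ ∧ adj D v w

data Desc : (k : ℕ) → {m : ℕ} → Graph (Fin m) → Set where
  one  : (D : Graph (Fin 1)) → adj D F.zero F.zero ≡ false → Desc 1 D
  step : ∀ {k n m} {D : Graph (Fin n)} {E : Graph (Fin m)} →
         Desc k D → (M : Step.Matching k D) → Iso E (Step.stepGraph k D M) →
         Desc (suc k) E

BlancheDescartes : ∀ {n} → Graph (Fin n) → Set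
BlancheDescartes G =
  Σ ℕ λ k → Σ ℕ λ m → Σ (Graph (Fin m)) λ D → Desc k D × InducedEmbedding G D

Stable : ∀ {V} → Graph V → Pred V 0ℓ → Set
Stable G S = ∀ {a b} → S a → S b → adj G a b ≡ false

SameComponent : ∀ {V} → Graph V → Pred V 0ℓ → V → V → Set
SameComponent G S = Star (λ x y → ¬ S x × ¬ S y × adj G x y ≡ true)

StronglySplitting : ∀ {V} → Graph V → Pred V 0ℓ → Set
StronglySplitting G S =
  (∀ {s u v} → S s → ¬ S u → ¬ S v →
     adj G s u ≡ true → adj G s v ≡ true → SameComponent G S u v → u ≡ v)
  ×
  (∀ {u s t} → ¬ S u → S s → S t →
     adj G u s ≡ true → adj G u t ≡ true → s ≡ t)

module Submission where

-- If S is the stable set added in the last step of the construction, G − S is the disjoint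
-- union of the copies of D_k, each joined to S by a matching. So a vertex set P meeting S is
-- split by P ∩ S, and a P avoiding S is split by a splitting set of one copy it meets, which
-- exists by induction; both properties pass to induced subgraphs.
--
-- Conversely, by induction on X: take a strongly splitting S of G[X] and embed G[X − S] into
-- some D_k, enlarged until the new stable set of D_(k+1) has room for a vertex for each s ∈ S
-- and a spare vertex for each position of each component of G[X] − S. Put S on the stable set
-- and every component into its own copy, choosing the copy's n-set so that the matching joins
-- each vertex to its S-neighbour; strong splitting says exactly that this is a matching.
-- Constructively the components of G[X] − S need not be decidable, but a certificate for S
-- and its components is a decidable property of finite data, so its double negation, which
-- is all the hypothesis yields, already produces one.

open import Defs
open import Level using (0ℓ)
open import Data.Bool as Bool using (true; false; _∧_)
open import Data.Bool.Properties using (∧-zeroʳ; ∧-identityʳ)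
open import Data.Empty using (⊥; ⊥-elim)
open import Data.Fin as F using (Fin)
open import Data.Fin.Properties
  using (any?; all?; ¬∀⟶∃¬; suc-injective; injective⇒≤; +↔⊎; *↔×; cast-involutive;
         inject≤-injective)
open import Data.Fin.Subset using (Subset; Nonempty; _∈_; _∉_; _─_; _∩_; _⊂_; inside; outside; ∣_∣)
open import Data.Fin.Subset.Induction using (Acc; acc; ⊂-wellFounded)
open import Data.Fin.Subset.Properties
  using (_∈?_; nonempty?; anySubset?; x∈p∧x∉q⇒x∈p─q; x∈p∩q⁺; p∩q≢∅⇒p─q⊂p; ∈⊤)
import Data.List as List
open import Data.Nat as ℕ using (ℕ; zero; suc; _+_; _*_; _∸_; _≤_; _<_; z≤n; s≤s)
open import Data.Nat.Properties
  using (≡-irrelevant; ≤-antisym; <⇒≱; ≤-refl; ≤-trans; +-comm; +-mono-≤; +-monoˡ-≤; +-monoʳ-≤;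
         *-monoˡ-≤; m≤m+n; m≤n+m; module ≤-Reasoning)
open import Data.Nat.Tactic.RingSolver using (solve)
open import Data.Product using (Σ; ∃; _×_; _,_; proj₁; proj₂)
open import Data.Product.Function.NonDependent.Propositional using (_×-↔_)
open import Data.Sum using (_⊎_; inj₁; inj₂)
open import Data.Sum.Function.Propositional using (_⊎-↔_)
open import Data.Sum.Properties using (inj₁-injective; inj₂-injective)
open import Data.Unit using (⊤; tt)
open import Data.Vec using (Vec; []; _∷_; tabulate; lookup; here; there)
open import Data.Vec.Properties using (≡-dec; lookup∘tabulate; lookup⇒[]=; []=⇒lookup; tabulate-cong)
open import Data.Vec.Properties.WithK using ([]=-irrelevant)
open import Effect.Monad using (RawMonad)
open import Function using (_∘_)
open import Function.Bundles using (_⇔_; mk⇔; _↔_; mk↔ₛ′; Inverse; Injection)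
open import Function.Definitions using (Injective)
open import Function.Properties.Inverse using (Inverse⇒Injection; ↔-trans; ↔-sym; ↔-refl)
open import Relation.Binary using (Rel) renaming (Decidable to Decidable₂)
open import Relation.Binary.Construct.Closure.ReflexiveTransitive
  using (Star; ε; _◅_; _◅◅_; gmap; reverse) renaming (map to Star-map)
open import Relation.Binary.PropositionalEquality
  using (_≡_; _≢_; _≗_; refl; sym; trans; cong; cong₂; subst; module ≡-Reasoning)
open import Relation.Nullary using (Irrelevant; ¬_; Dec; yes; no; ¬?; _×-dec_; _→-dec_)
open import Relation.Nullary.Decidable
  using (⌊_⌋; map′; isYes≗does; does-⇔; ¬¬-excluded-middle; decidable-stable)
open import Relation.Nullary.Negation using (¬¬-Monad)
open import Relation.Unary using (Pred; Decidable; Satisfiable; _⊆_)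

open RawMonad (¬¬-Monad {0ℓ}) using (pure; _>>=_)

⌊⌋-sound : ∀ {A : Set} (a? : Dec A) → ⌊ a? ⌋ ≡ true → A
⌊⌋-sound (yes a) _ = a

⌊⌋-complete : ∀ {A : Set} (a? : Dec A) → A → ⌊ a? ⌋ ≡ true
⌊⌋-complete (yes _) _ = refl
⌊⌋-complete (no ¬a) a = ⊥-elim (¬a a)

⌊⌋-cong : ∀ {A B : Set} (a? : Dec A) (b? : Dec B) → (A → B) → (B → A) → ⌊ a? ⌋ ≡ ⌊ b? ⌋
⌊⌋-cong a? b? f g = trans (isYes≗does a?) (trans (does-⇔ (mk⇔ f g) a? b?) (sym (isYes≗does b?)))

≡⌊⌋ : ∀ {A : Set} {b} (a? : Dec A) → (b ≡ true → A) → (A → b ≡ true) → b ≡ ⌊ a? ⌋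
≡⌊⌋ {b = false} (yes a) _ to-b = to-b a
≡⌊⌋ {b = false} (no _) _ _ = refl
≡⌊⌋ {b = true} (yes _) _ _ = refl
≡⌊⌋ {b = true} (no ¬a) to-a _ = ⊥-elim (¬a (to-a refl))

≡⌊⌋∧ : ∀ {A : Set} {b} (a? : Dec A) → (b ≡ true → A) → b ≡ ⌊ a? ⌋ ∧ b
≡⌊⌋∧ {b = false} a? _ = sym (∧-zeroʳ ⌊ a? ⌋)
≡⌊⌋∧ {b = true} a? to-a = sym (trans (∧-identityʳ ⌊ a? ⌋) (⌊⌋-complete a? (to-a refl)))

∧-true⁻ : ∀ {a b} → a ∧ b ≡ true → a ≡ true × b ≡ true
∧-true⁻ {true} {true} _ = refl , refl

-- Splitting sets of induced subgraphs

Link : ∀ {V} → Graph V → Pred V 0ℓ → Pred V 0ℓ → V → V → Set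
Link H P S x y = P x × ¬ S x × P y × ¬ S y × adj H x y ≡ true

record IsSplittingSet {V} (H : Graph V) (P S : Pred V 0ℓ) : Set where
  field
    S⊆P : S ⊆ P
    nonempty : Satisfiable S
    stable : Stable H S
    one-per-component : ∀ {s u v} → S s → P u → ¬ S u → P v → ¬ S v →
      adj H s u ≡ true → adj H s v ≡ true → Star (Link H P S) u v → u ≡ v
    one-in-S : ∀ {u s t} → P u → ¬ S u → S s → S t →
      adj H u s ≡ true → adj H u t ≡ true → s ≡ t

HereditarilySplittable : ∀ {V} → Graph V → Set₁
HereditarilySplittable {V} H =
  (P : Pred V 0ℓ) → Decidable P → Satisfiable P → ∃ (IsSplittingSet H P)

module _ {V W} {G : Graph V} {H : Graph W} (f : V → W) (f-injective : Injective _≡_ _≡_ f)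
         (f-adj : ∀ x y → adj G x y ≡ adj H (f x) (f y))
         {P : Pred V 0ℓ} {Q : Pred W 0ℓ} (P⇒Q : ∀ {v} → P v → Q (f v)) (Q⇒P : ∀ {v} → Q (f v) → P v)
         (Q⊆image : ∀ {w} → Q w → ∃ λ v → f v ≡ w) where

  splittingSet-pullback : ∀ {S} → IsSplittingSet H Q S → IsSplittingSet G P (S ∘ f)
  splittingSet-pullback {S} σ = record
    { S⊆P = Q⇒P ∘ S⊆P
    ; nonempty = nonempty′
    ; stable = λ {a} {b} sa sb → trans (f-adj a b) (stable sa sb)
    ; one-per-component = λ {s} {u} {v} ss pu nu pv nv su sv path → f-injective
        (one-per-component ss (P⇒Q pu) nu (P⇒Q pv) nv
          (trans (sym (f-adj s u)) su) (trans (sym (f-adj s v)) sv) (gmap f link-image path))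
    ; one-in-S = λ {u} {s} {t} pu nu ss st us ut → f-injective
        (one-in-S (P⇒Q pu) nu ss st (trans (sym (f-adj u s)) us) (trans (sym (f-adj u t)) ut))
    }
    where
    open IsSplittingSet σ
    link-image : ∀ {x y} → Link G P (S ∘ f) x y → Link H Q S (f x) (f y)
    link-image {x} {y} (px , nx , py , ny , xy) = P⇒Q px , nx , P⇒Q py , ny , trans (sym (f-adj x y)) xy
    nonempty′ : Satisfiable (S ∘ f)
    nonempty′ with nonempty
    ... | w , sw with Q⊆image (S⊆P sw)
    ... | v , refl = v , sw

hereditarilySplittable-iso : ∀ {V W} {E : Graph V} {H : Graph W} →
  Iso E H → HereditarilySplittable H → HereditarilySplittable E
hereditarilySplittable-iso (φ , φ-adj) hH P P? (v , pv) =
  let S , σ = hH (P ∘ from) (P? ∘ from) (to v , P-from-to pv)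
  in S ∘ to , splittingSet-pullback to (Injection.injective (Inverse⇒Injection φ)) φ-adj
                P-from-to (subst P (strictlyInverseʳ _)) (λ {w} _ → from w , strictlyInverseˡ w) σ
  where
  open Inverse φ
  P-from-to : ∀ {v} → P v → P (from (to v))
  P-from-to {v} = subst P (sym (strictlyInverseʳ v))

-- The graphs of the construction

module StepGraph (k : ℕ) {n : ℕ} (D : Graph (Fin n)) (M : Step.Matching k D) where
  open Step k D
  open Matching M

  SG : Graph StepV
  SG = stepGraph M

  copy-≡ : {c d : Copies} → proj₁ c ≡ proj₁ d → c ≡ d
  copy-≡ {T , p} {.T , q} refl = cong (T ,_) (≡-irrelevant p q)

  adj-copies : ∀ c d {x y} → adj SG (inj₂ (c , x)) (inj₂ (d , y)) ≡ true → c ≡ d × adj D x y ≡ true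
  adj-copies c d e with ∧-true⁻ e
  ... | same , xy = copy-≡ (⌊⌋-sound (≡-dec Bool._≟_ (proj₁ c) (proj₁ d)) same) , xy

  adj-within-copy : ∀ c x y → adj SG (inj₂ (c , x)) (inj₂ (c , y)) ≡ adj D x y
  adj-within-copy c x y rewrite ⌊⌋-complete (≡-dec Bool._≟_ (proj₁ c) (proj₁ c)) refl = refl

  matched : ∀ {c x s} → ⌊ μ c x F.≟ s ⌋ ≡ true → μ c x ≡ s
  matched {c} {x} {s} = ⌊⌋-sound (μ c x F.≟ s)

  module _ {P S : Pred StepV 0ℓ} (P∩stable⊆S : ∀ {s} → P (inj₁ s) → S (inj₁ s)) where

    -- Copies meet only in the stable set, and S contains all of it that lies in P.
    link-path-within-copy : ∀ {c x w} → Star (Link SG P S) (inj₂ (c , x)) w →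
      ∃ λ y → w ≡ inj₂ (c , y) ×
        Star (Link D (λ v → P (inj₂ (c , v))) (λ v → S (inj₂ (c , v)))) x y
    link-path-within-copy {x = x} ε = x , refl , ε
    link-path-within-copy (_◅_ {j = inj₁ s} (_ , _ , ps , ns , _) _) = ⊥-elim (ns (P∩stable⊆S ps))
    link-path-within-copy {c} (_◅_ {j = inj₂ (d , y)} (px , nx , py , ny , e) rest)
      with adj-copies c d e
    ... | refl , xy with link-path-within-copy rest
    ... | z , eq , path = z , eq , (px , nx , py , ny , xy) ◅ path

  copy-embedding : ∀ c → InducedEmbedding D SG
  copy-embedding c = (λ x → inj₂ (c , x)) , (λ { refl → refl }) , λ x y → sym (adj-within-copy c x y)

  IsStable : Pred StepV 0ℓ
  IsStable (inj₁ _) = ⊤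
  IsStable (inj₂ _) = ⊥

  module MeetsStable (P : Pred StepV 0ℓ) {s₀ : Fin sz} (ps₀ : P (inj₁ s₀)) where
    S : Pred StepV 0ℓ
    S x = P x × IsStable x

    splitting : IsSplittingSet SG P S
    splitting = record
      { S⊆P = proj₁ ; nonempty = inj₁ s₀ , ps₀ , tt ; stable = stable
      ; one-per-component = one-per-component ; one-in-S = one-in-S }
      where
      stable : Stable SG S
      stable {inj₁ _} {inj₁ _} _ _ = refl
      one-in-S : ∀ {u s t} → P u → ¬ S u → S s → S t → adj SG u s ≡ true → adj SG u t ≡ true → s ≡ t
      one-in-S {inj₁ _} pu nu _ _ _ _ = ⊥-elim (nu (pu , tt))
      one-in-S {inj₂ _} {inj₁ _} {inj₁ _} _ _ _ _ us ut = cong inj₁ (trans (sym (matched us)) (matched ut))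
      one-per-component : ∀ {s u v} → S s → P u → ¬ S u → P v → ¬ S v →
        adj SG s u ≡ true → adj SG s v ≡ true → Star (Link SG P S) u v → u ≡ v
      one-per-component {inj₁ _} {inj₁ _} _ pu nu _ _ _ _ _ = ⊥-elim (nu (pu , tt))
      one-per-component {inj₁ _} {inj₂ (c , x)} _ _ _ _ _ su sv path
        with link-path-within-copy (λ ps → ps , tt) path
      ... | y , refl , _ = cong (λ z → inj₂ (c , z)) (inj c (trans (matched su) (sym (matched sv))))

  module AvoidsStable (P : Pred StepV 0ℓ) (P∌stable : ∀ s → ¬ P (inj₁ s)) (c₀ : Copies)
                      {S₀ : Pred (Fin n) 0ℓ} (σ₀ : IsSplittingSet D (λ x → P (inj₂ (c₀ , x))) S₀) where
    module σ₀ = IsSplittingSet σ₀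

    S : Pred StepV 0ℓ
    S (inj₁ _) = ⊥
    S (inj₂ (c , x)) = c ≡ c₀ × S₀ x

    splitting : IsSplittingSet SG P S
    splitting = record
      { S⊆P = S⊆P ; nonempty = nonempty ; stable = stable
      ; one-per-component = one-per-component ; one-in-S = one-in-S }
      where
      S⊆P : S ⊆ P
      S⊆P {inj₂ _} (refl , sx) = σ₀.S⊆P sx
      nonempty : Satisfiable S
      nonempty with σ₀.nonempty
      ... | x , sx = inj₂ (c₀ , x) , refl , sx
      stable : Stable SG S
      stable {inj₂ (c , x)} {inj₂ (_ , y)} (refl , sx) (refl , sy)
        rewrite adj-within-copy c x y = σ₀.stable sx sy
      one-in-S : ∀ {u s t} → P u → ¬ S u → S s → S t → adj SG u s ≡ true → adj SG u t ≡ true → s ≡ t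
      one-in-S {inj₁ u} pu _ _ _ _ _ = ⊥-elim (P∌stable u pu)
      one-in-S {inj₂ (c , x)} {inj₂ (_ , y)} {inj₂ (_ , z)} pu nu (refl , sy) (refl , sz) us ut
        with adj-copies c c₀ us | adj-copies c c₀ ut
      ... | refl , xy | _ , xz = cong (λ w → inj₂ (c₀ , w)) (σ₀.one-in-S pu (nu ∘ (refl ,_)) sy sz xy xz)
      one-per-component : ∀ {s u v} → S s → P u → ¬ S u → P v → ¬ S v →
        adj SG s u ≡ true → adj SG s v ≡ true → Star (Link SG P S) u v → u ≡ v
      one-per-component {inj₂ _} {inj₁ u} _ pu _ _ _ _ _ _ = ⊥-elim (P∌stable u pu)
      one-per-component {inj₂ _} {inj₂ _} {inj₁ v} _ _ _ pv _ _ _ _ = ⊥-elim (P∌stable v pv)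
      one-per-component {inj₂ (_ , a)} {inj₂ (c , x)} {inj₂ (d , y)} (refl , sa) pu nu pv nv su sv path
        with adj-copies c₀ c su | adj-copies c₀ d sv
      ... | refl , ax | refl , ay with link-path-within-copy (λ {s} ps → ⊥-elim (P∌stable s ps)) path
      ... | _ , refl , path₀ = cong (λ w → inj₂ (c₀ , w))
        (σ₀.one-per-component sa pu (nu ∘ (refl ,_)) pv (nv ∘ (refl ,_)) ax ay (Star-map link₀ path₀))
        where
        link₀ : ∀ {x y} → Link D (λ v → P (inj₂ (c₀ , v))) (λ v → S (inj₂ (c₀ , v))) x y →
                Link D (λ v → P (inj₂ (c₀ , v))) S₀ x y
        link₀ (px , nx , py , ny , xy) = px , nx ∘ (refl ,_) , py , ny ∘ (refl ,_) , xy

  hereditarilySplittable-step : HereditarilySplittable D → HereditarilySplittable SG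
  hereditarilySplittable-step hD P P? (w , pw) with any? (P? ∘ inj₁)
  ... | yes (s₀ , ps₀) = MeetsStable.S P ps₀ , MeetsStable.splitting P ps₀
  ... | no P∌stable with w | pw
  ...   | inj₁ s | ps = ⊥-elim (P∌stable (s , ps))
  ...   | inj₂ (c₀ , x₀) | px₀
        with hD (λ x → P (inj₂ (c₀ , x))) (λ x → P? (inj₂ (c₀ , x))) (x₀ , px₀)
  ...     | S₀ , σ₀ = AvoidsStable.S P (λ s ps → P∌stable (s , ps)) c₀ σ₀
                    , AvoidsStable.splitting P (λ s ps → P∌stable (s , ps)) c₀ σ₀

hereditarilySplittable-Desc : ∀ {k m} {D : Graph (Fin m)} → Desc k D → HereditarilySplittable D
hereditarilySplittable-Desc (one D loopless) P P? (v , pv) = P , record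
  { S⊆P = λ pv → pv ; nonempty = v , pv ; stable = stable
  ; one-per-component = λ _ pu nu _ _ _ _ _ → ⊥-elim (nu pu)
  ; one-in-S = λ pu nu _ _ _ _ → ⊥-elim (nu pu) }
  where
  stable : Stable D P
  stable {F.zero} {F.zero} _ _ = loopless
hereditarilySplittable-Desc (step {k} {D = D} d M iso) =
  hereditarilySplittable-iso iso (StepGraph.hereditarilySplittable-step k D M (hereditarilySplittable-Desc d))

hereditarilySplittable-embedding : ∀ {m m′} {G : Graph (Fin m)} {H : Graph (Fin m′)} →
  InducedEmbedding G H → HereditarilySplittable H → HereditarilySplittable G
hereditarilySplittable-embedding {G = G} (f , f-injective , f-adj) hH P P? (v , pv) with
  hH (λ w → ∃ λ u → f u ≡ w × P u) (λ w → any? λ u → (f u F.≟ w) ×-dec P? u) (f v , v , refl , pv)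
... | S , σ = S ∘ f , splittingSet-pullback f f-injective f-adj (λ {u} pu → u , refl , pu)
  (λ { (u , fu≡fv , pu) → subst P (f-injective fu≡fv) pu }) (λ (u , fu≡w , _) → u , fu≡w) σ

HasSplittingSet : ∀ {V} → Graph V → Set₁
HasSplittingSet {V} H = Σ (Pred V 0ℓ) λ S → Satisfiable S × Stable H S × StronglySplitting H S

InducedSplittable : ∀ {m} → Graph (Fin m) → Set₁
InducedSplittable {m} G = (X : Subset m) → Nonempty X → HasSplittingSet (G [ X ])

hereditarilySplittable⇒inducedSplittable : ∀ {m} {G : Graph (Fin m)} →
  HereditarilySplittable G → InducedSplittable G
hereditarilySplittable⇒inducedSplittable {m} {G} hG X (x , x∈X) with hG (_∈ X) (_∈? X) (x , x∈X)
... | S , σ = S ∘ proj₁ , nonempty′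
  , (λ {a} {b} → stable {proj₁ a} {proj₁ b})
  , (λ {_} {u} {v} ss nu nv su sv path → restrict-≡ (one-per-component ss (proj₂ u) nu (proj₂ v) nv su sv
      (gmap proj₁ (λ {a} {b} (na , nb , ab) → proj₂ a , na , proj₂ b , nb , ab) path)))
  , (λ {u} nu ss st us ut → restrict-≡ (one-in-S (proj₂ u) nu ss st us ut))
  where
  open IsSplittingSet σ
  nonempty′ : ∃ λ (a : Σ (Fin m) (_∈ X)) → S (proj₁ a)
  nonempty′ with nonempty
  ... | v , sv = (v , S⊆P sv) , sv
  restrict-≡ : ∀ {u v : Σ (Fin m) (_∈ X)} → proj₁ u ≡ proj₁ v → u ≡ v
  restrict-≡ {u , p} {.u , q} refl = cong (u ,_) ([]=-irrelevant p q)

BlancheDescartes⇒inducedSplittable : ∀ {m} {G : Graph (Fin m)} → BlancheDescartes G → InducedSplittable G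
BlancheDescartes⇒inducedSplittable (_ , _ , _ , d , G↪D) = hereditarilySplittable⇒inducedSplittable
  (hereditarilySplittable-embedding G↪D (hereditarilySplittable-Desc d))

-- Certificates

module _ {m} {P : Pred (Fin m) 0ℓ} (P? : Decidable P) where

  toSubset : Subset m
  toSubset = tabulate (λ x → ⌊ P? x ⌋)

  ∈-toSubset⁺ : ∀ {x} → P x → x ∈ toSubset
  ∈-toSubset⁺ {x} px = lookup⇒[]= x _ (trans (lookup∘tabulate _ x) (⌊⌋-complete (P? x) px))

  ∈-toSubset⁻ : ∀ {x} → x ∈ toSubset → P x
  ∈-toSubset⁻ {x} x∈ = ⌊⌋-sound (P? x) (trans (sym (lookup∘tabulate _ x)) ([]=⇒lookup x∈))

pick : ∀ {m} → Subset m → Fin m → Fin m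
pick p d with nonempty? p
... | yes (x , _) = x
... | no _ = d

pick-∈ : ∀ {m} {p : Subset m} d → Nonempty p → pick p d ∈ p
pick-∈ {p = p} d ne with nonempty? p
... | yes (_ , x∈p) = x∈p
... | no empty = ⊥-elim (empty ne)

pick-default-irrelevant : ∀ {m} {p : Subset m} d d′ → Nonempty p → pick p d ≡ pick p d′
pick-default-irrelevant {p = p} d d′ ne with nonempty? p
... | yes _ = refl
... | no empty = ⊥-elim (empty ne)

module Representatives {m} {_~_ : Rel (Fin m) 0ℓ} (_~?_ : Decidable₂ _~_) where

  class : Fin m → Subset m
  class u = toSubset (u ~?_)

  representative : Fin m → Fin m
  representative u = pick (class u) u

  ~-representative : ∀ {u} → u ~ u → u ~ representative u
  ~-representative {u} u~u = ∈-toSubset⁻ (u ~?_) (pick-∈ u (u , ∈-toSubset⁺ (u ~?_) u~u))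

  representative-cong : ∀ {u v} → u ~ u → (∀ {w} → u ~ w → v ~ w) → (∀ {w} → v ~ w → u ~ w) →
    representative u ≡ representative v
  representative-cong {u} {v} u~u u⇒v v⇒u = begin
    pick (class u) u ≡⟨ cong (λ p → pick p u) class-u≡class-v ⟩
    pick (class v) u ≡⟨ pick-default-irrelevant u v (subst Nonempty class-u≡class-v u∈class-u) ⟩
    pick (class v) v ∎
    where
    open ≡-Reasoning
    class-u≡class-v : class u ≡ class v
    class-u≡class-v = tabulate-cong (λ w → ⌊⌋-cong (u ~? w) (v ~? w) u⇒v v⇒u)
    u∈class-u : Nonempty (class u)
    u∈class-u = u , ∈-toSubset⁺ (u ~?_) u~u

Searchable : Set → Set₁
Searchable A = ∀ {P : Pred A 0ℓ} → Decidable P → Dec (∃ P)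

searchable-Vec : ∀ {A} → Searchable A → ∀ k → Searchable (Vec A k)
searchable-Vec search zero P? = map′ (λ p → [] , p) (λ { ([] , p) → p }) (P? [])
searchable-Vec search (suc k) P? =
  map′ (λ (a , v , p) → a ∷ v , p) (λ { (a ∷ v , p) → a , v , p })
    (search λ a → searchable-Vec search k (λ v → P? (a ∷ v)))

¬¬-∀-Fin : ∀ {m} {P : Pred (Fin m) 0ℓ} → (∀ i → ¬ ¬ P i) → ¬ ¬ (∀ i → P i)
¬¬-∀-Fin {zero} _ = pure λ ()
¬¬-∀-Fin {suc m} h = do
  p₀ ← h F.zero
  ps ← ¬¬-∀-Fin (h ∘ F.suc)
  pure λ { F.zero → p₀ ; (F.suc i) → ps i }

module Certificates {m} (G : Graph (Fin m)) where

  -- A splitting set S of G[X] in decidable form; label identifies the components of G[X] − S.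
  record IsCertificate (X S : Subset m) (label : Fin m → Fin m) : Set where
    field
      S⊆X : ∀ x → x ∈ S → x ∈ X
      S-nonempty : Nonempty S
      S-stable : ∀ a b → a ∈ S → b ∈ S → adj G a b ≡ false
      one-in-S : ∀ u s t → u ∈ X → u ∉ S → s ∈ S → t ∈ S →
        adj G u s ≡ true → adj G u t ≡ true → s ≡ t
      label-edge : ∀ u v → u ∈ X → u ∉ S → v ∈ X → v ∉ S → adj G u v ≡ true → label u ≡ label v
      one-per-label : ∀ s u v → s ∈ S → u ∈ X → u ∉ S → v ∈ X → v ∉ S → label u ≡ label v →
        adj G s u ≡ true → adj G s v ≡ true → u ≡ v

  isCertificate? : ∀ X S label → Dec (IsCertificate X S label)
  isCertificate? X S label = map′
    (λ (a , b , c , d , e , f) → record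
      { S⊆X = a ; S-nonempty = b ; S-stable = c ; one-in-S = d ; label-edge = e ; one-per-label = f })
    (λ κ → let open IsCertificate κ in S⊆X , S-nonempty , S-stable , one-in-S , label-edge , one-per-label)
    ((all? λ x → x ∈? S →-dec x ∈? X)
    ×-dec nonempty? S
    ×-dec (all? λ a → all? λ b → a ∈? S →-dec b ∈? S →-dec adj G a b Bool.≟ false)
    ×-dec (all? λ u → all? λ s → all? λ t → u ∈? X →-dec ¬? (u ∈? S) →-dec s ∈? S →-dec
             t ∈? S →-dec adj G u s Bool.≟ true →-dec adj G u t Bool.≟ true →-dec s F.≟ t)
    ×-dec (all? λ u → all? λ v → u ∈? X →-dec ¬? (u ∈? S) →-dec v ∈? X →-dec ¬? (v ∈? S) →-dec
             adj G u v Bool.≟ true →-dec label u F.≟ label v)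
    ×-dec (all? λ s → all? λ u → all? λ v → s ∈? S →-dec u ∈? X →-dec ¬? (u ∈? S) →-dec
             v ∈? X →-dec ¬? (v ∈? S) →-dec label u F.≟ label v →-dec
             adj G s u Bool.≟ true →-dec adj G s v Bool.≟ true →-dec u F.≟ v))

  Certificate : Subset m → Set
  Certificate X = Σ (Subset m) λ S → Σ (Vec (Fin m) m) λ labels → IsCertificate X S (lookup labels)

  certificate? : ∀ X → Dec (Certificate X)
  certificate? X = anySubset? λ S →
    searchable-Vec (λ P? → any? P?) m λ labels → isCertificate? X S (lookup labels)

  module FromSplittingSet (simple : IsSimple G) (X : Subset m) {S : Pred (Σ (Fin m) (_∈ X)) 0ℓ}
    (S-nonempty : Satisfiable S) (S-stable : Stable (G [ X ]) S) (S-splitting : StronglySplitting (G [ X ]) S)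
    where

    InS : Pred (Fin m) 0ℓ
    InS i = Σ (i ∈ X) λ p → S (i , p)

    _~_ : Rel (Fin m) 0ℓ
    u ~ v = Σ (u ∈ X) λ pu → Σ (v ∈ X) λ pv → SameComponent (G [ X ]) S (u , pu) (v , pv)

    component-path : ∀ {u v} → u ~ v → ∀ pu pv → SameComponent (G [ X ]) S (u , pu) (v , pv)
    component-path (pu′ , pv′ , path) pu pv rewrite []=-irrelevant pu pu′ | []=-irrelevant pv pv′ = path

    flip-link : ∀ {x y} → ¬ S x × ¬ S y × adj G (proj₁ x) (proj₁ y) ≡ true →
                ¬ S y × ¬ S x × adj G (proj₁ y) (proj₁ x) ≡ true
    flip-link {x} {y} (nx , ny , xy) = ny , nx , trans (proj₁ simple (proj₁ y) (proj₁ x)) xy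

    module _ (InS? : Decidable InS) (_~?_ : Decidable₂ _~_) where
      open Representatives _~?_

      S′ : Subset m
      S′ = toSubset InS?

      ∈S′⇒S : ∀ {i} → i ∈ S′ → (p : i ∈ X) → S (i , p)
      ∈S′⇒S i∈S′ p with ∈-toSubset⁻ InS? i∈S′
      ... | p′ , s rewrite []=-irrelevant p p′ = s

      ∉S′⇒¬S : ∀ {i} (p : i ∈ X) → i ∉ S′ → ¬ S (i , p)
      ∉S′⇒¬S p i∉S′ s = i∉S′ (∈-toSubset⁺ InS? (p , s))

      S′⊆X : ∀ x → x ∈ S′ → x ∈ X
      S′⊆X x x∈S′ = proj₁ (∈-toSubset⁻ InS? x∈S′)

      certificate : (label : Fin m → Fin m) → label ≗ representative → IsCertificate X S′ label
      certificate label label≗rep = record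
        { S⊆X = S′⊆X
        ; S-nonempty = let ((s , ps) , s∈S) = S-nonempty in s , ∈-toSubset⁺ InS? (ps , s∈S)
        ; S-stable = λ a b a∈S′ b∈S′ →
            S-stable {a , S′⊆X a a∈S′} {b , S′⊆X b b∈S′} (∈S′⇒S a∈S′ _) (∈S′⇒S b∈S′ _)
        ; one-in-S = λ u s t pu u∉S′ s∈S′ t∈S′ us ut → cong proj₁
            (proj₂ S-splitting {u , pu} {s , S′⊆X s s∈S′} {t , S′⊆X t t∈S′}
              (∉S′⇒¬S pu u∉S′) (∈S′⇒S s∈S′ _) (∈S′⇒S t∈S′ _) us ut)
        ; label-edge = λ u v pu u∉S′ pv v∉S′ uv →
            let edge = ∉S′⇒¬S pu u∉S′ , ∉S′⇒¬S pv v∉S′ , uv in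
            trans (label≗rep u) (trans (representative-cong (pu , pu , ε)
              (λ (_ , pw , path) → pv , pw , flip-link edge ◅ component-path (_ , pw , path) pu pw)
              (λ (_ , pw , path) → pu , pw , edge ◅ component-path (_ , pw , path) pv pw))
              (sym (label≗rep v)))
        ; one-per-label = λ s u v s∈S′ pu u∉S′ pv v∉S′ same-label su sv → cong proj₁
            (proj₁ S-splitting {s , S′⊆X s s∈S′} {u , pu} {v , pv}
              (∈S′⇒S s∈S′ _) (∉S′⇒¬S pu u∉S′) (∉S′⇒¬S pv v∉S′) su sv
              (same-label-path (trans (sym (label≗rep u)) (trans same-label (label≗rep v)))))
        }
        where
        same-label-path : ∀ {u v pu pv} → representative u ≡ representative v →
          SameComponent (G [ X ]) S (u , pu) (v , pv)
        same-label-path {u} {v} {pu} {pv} same-label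
          with ~-representative (pu , pu , ε) | ~-representative (pv , pv , ε)
        ... | u~r | v~r′ rewrite same-label =
          component-path u~r pu (proj₁ (proj₂ v~r′))
            ◅◅ reverse flip-link (component-path v~r′ pv (proj₁ (proj₂ v~r′)))

    ¬¬certificate : ¬ ¬ Certificate X
    ¬¬certificate = do
      InS? ← ¬¬-∀-Fin λ _ → ¬¬-excluded-middle
      _~?_ ← ¬¬-∀-Fin λ _ → ¬¬-∀-Fin λ _ → ¬¬-excluded-middle
      pure (S′ InS? _~?_ , tabulate (Representatives.representative _~?_)
           , certificate InS? _~?_ _ (lookup∘tabulate _))

  splittable⇒certificate : IsSimple G → InducedSplittable G → ∀ X → Nonempty X → Certificate X
  splittable⇒certificate simple splittable X ne with splittable X ne
  ... | _ , S-nonempty , S-stable , S-splitting = decidable-stable (certificate? X)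
    (FromSplittingSet.¬¬certificate simple X S-nonempty S-stable S-splitting)

-- Realising a step of the construction

enumerate : ∀ {k} (p : Subset k) → Fin ∣ p ∣ → Fin k
enumerate (inside ∷ p) F.zero = F.zero
enumerate (inside ∷ p) (F.suc i) = F.suc (enumerate p i)
enumerate (outside ∷ p) i = F.suc (enumerate p i)

enumerate-injective : ∀ {k} (p : Subset k) → Injective _≡_ _≡_ (enumerate p)
enumerate-injective (inside ∷ p) {F.zero} {F.zero} _ = refl
enumerate-injective (inside ∷ p) {F.suc i} {F.suc j} e = cong F.suc (enumerate-injective p (suc-injective e))
enumerate-injective (outside ∷ p) e = enumerate-injective p (suc-injective e)

enumerate-∈ : ∀ {k} (p : Subset k) i → enumerate p i ∈ p
enumerate-∈ (inside ∷ p) F.zero = here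
enumerate-∈ (inside ∷ p) (F.suc i) = there (enumerate-∈ p i)
enumerate-∈ (outside ∷ p) i = there (enumerate-∈ p i)

enumerate-onto : ∀ {k} (p : Subset k) {t} → t ∈ p → ∃ λ i → enumerate p i ≡ t
enumerate-onto (inside ∷ p) here = F.zero , refl
enumerate-onto (inside ∷ p) (there t∈p) with enumerate-onto p t∈p
... | i , refl = F.suc i , refl
enumerate-onto (outside ∷ p) (there t∈p) with enumerate-onto p t∈p
... | i , refl = i , refl

∣p∣≡n : ∀ {k n} (p : Subset k) (μ : Fin n → Fin k) → Injective _≡_ _≡_ μ →
  (∀ i → μ i ∈ p) → (∀ {t} → t ∈ p → ∃ λ i → μ i ≡ t) → ∣ p ∣ ≡ n
∣p∣≡n p μ μ-injective μ∈p μ-onto = ≤-antisym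
  (injective⇒≤ {f = proj₁ ∘ μ-onto ∘ enumerate-∈ p} λ {i} {j} e → enumerate-injective p
    (trans (sym (proj₂ (μ-onto (enumerate-∈ p i))))
      (trans (cong μ e) (proj₂ (μ-onto (enumerate-∈ p j))))))
  (injective⇒≤ {f = proj₁ ∘ enumerate-onto p ∘ μ∈p} λ {i} {j} e → μ-injective
    (trans (sym (proj₂ (enumerate-onto p (μ∈p i))))
      (trans (cong (enumerate p) e) (proj₂ (enumerate-onto p (μ∈p j))))))

module _ {n k} (μ : Fin n → Fin k) where

  image : Subset k
  image = toSubset (λ t → any? (λ i → μ i F.≟ t))

  ∈-image : ∀ i → μ i ∈ image
  ∈-image i = ∈-toSubset⁺ (λ t → any? (λ i → μ i F.≟ t)) (i , refl)

  image-onto : ∀ {t} → t ∈ image → ∃ λ i → μ i ≡ t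
  image-onto = ∈-toSubset⁻ (λ t → any? (λ i → μ i F.≟ t))

  ∣image∣ : Injective _≡_ _≡_ μ → ∣ image ∣ ≡ n
  ∣image∣ μ-injective = ∣p∣≡n image μ μ-injective ∈-image image-onto

Finite : Set → Set
Finite A = Σ ℕ λ c → Fin c ↔ A

Σ-Subset-finite : ∀ k {P : Pred (Subset k) 0ℓ} → Decidable P → (∀ {p} → Irrelevant (P p)) →
  Finite (Σ (Subset k) P)
Σ-Subset-finite zero {P} P? P-irrelevant with P? []
... | yes p = 1 , mk↔ₛ′ (λ _ → [] , p) (λ _ → F.zero) (λ { ([] , q) → cong ([] ,_) (P-irrelevant p q) })
                        (λ { F.zero → refl ; (F.suc ()) })
... | no ¬p = 0 , mk↔ₛ′ (λ ()) (λ { ([] , p) → ⊥-elim (¬p p) }) (λ { ([] , p) → ⊥-elim (¬p p) })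
                        (λ ())
Σ-Subset-finite (suc k) {P} P? P-irrelevant
  with Σ-Subset-finite k (P? ∘ (inside ∷_)) P-irrelevant | Σ-Subset-finite k (P? ∘ (outside ∷_)) P-irrelevant
... | c₁ , φ₁ | c₂ , φ₂ = c₁ + c₂ , ↔-trans +↔⊎ (↔-trans (φ₁ ⊎-↔ φ₂) split)
  where
  split : (Σ (Subset k) (P ∘ (inside ∷_)) ⊎ Σ (Subset k) (P ∘ (outside ∷_))) ↔ Σ (Subset (suc k)) P
  split = mk↔ₛ′
    (λ { (inj₁ (p , q)) → inside ∷ p , q ; (inj₂ (p , q)) → outside ∷ p , q })
    (λ { (inside ∷ p , q) → inj₁ (p , q) ; (outside ∷ p , q) → inj₂ (p , q) })
    (λ { (inside ∷ _ , _) → refl ; (outside ∷ _ , _) → refl })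
    (λ { (inj₁ _) → refl ; (inj₂ _) → refl })

module Realisation (k : ℕ) {n : ℕ} (D : Graph (Fin n)) where
  open Step k D

  -- abstract here and below only stops the type checker from unfolding the enumeration of the copies.
  abstract
    copies-finite : Finite Copies
    copies-finite = Σ-Subset-finite sz (λ T → ∣ T ∣ ℕ.≟ n) ≡-irrelevant

  order : ℕ
  order = sz + proj₁ copies-finite * n

  vertices : Fin order ↔ StepV
  vertices = ↔-trans +↔⊎ (↔-refl ⊎-↔ ↔-trans *↔× (proj₂ copies-finite ×-↔ ↔-refl))

  open Inverse vertices using (to; from; strictlyInverseˡ)

  realise : Matching → Graph (Fin order)
  realise M = mkGraph λ x y → adj (stepGraph M) (to x) (to y)

  realise-Desc : Desc k D → ∀ M → Desc (suc k) (realise M)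
  realise-Desc d M = step d M (vertices , λ _ _ → refl)

  stepGraph↪realise : ∀ M → InducedEmbedding (stepGraph M) (realise M)
  stepGraph↪realise M = from , Injection.injective (Inverse⇒Injection (↔-sym vertices))
    , λ x y → sym (cong₂ (adj (stepGraph M)) (strictlyInverseˡ x) (strictlyInverseˡ y))

  enumerationMatching : Matching
  enumerationMatching = record
    { μ = λ (T , ∣T∣≡n) v → enumerate T (F.cast (sym ∣T∣≡n) v)
    ; inj = λ (T , ∣T∣≡n) {v} {w} e → trans (sym (cast-involutive ∣T∣≡n (sym ∣T∣≡n) v))
        (trans (cong (F.cast ∣T∣≡n) (enumerate-injective T e)) (cast-involutive ∣T∣≡n (sym ∣T∣≡n) w))
    ; into = λ (T , _) v → enumerate-∈ T _
    ; onto = λ (T , ∣T∣≡n) t t∈T → let (i , e) = enumerate-onto T t∈T in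
        F.cast ∣T∣≡n i , trans (cong (enumerate T) (cast-involutive (sym ∣T∣≡n) ∣T∣≡n i)) e
    }

InducedEmbedding-trans : ∀ {U V W} {G : Graph U} {H : Graph V} {K : Graph W} →
  InducedEmbedding G H → InducedEmbedding H K → InducedEmbedding G K
InducedEmbedding-trans (f , f-injective , f-adj) (g , g-injective , g-adj) =
  g ∘ f , f-injective ∘ g-injective , λ x y → trans (f-adj x y) (g-adj (f x) (f y))

Desc-level-positive : ∀ {k m} {D : Graph (Fin m)} → Desc k D → 1 ≤ k
Desc-level-positive (one _ _) = s≤s z≤n
Desc-level-positive (step _ _ _) = s≤s z≤n

n≤k*[n∸1]+1 : ∀ {k} n → 1 ≤ k → n ≤ k * (n ∸ 1) + 1
n≤k*[n∸1]+1 zero _ = z≤n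
n≤k*[n∸1]+1 {suc k} (suc n) _ = subst (_≤ n + k * n + 1) (+-comm n 1) (+-monoˡ-≤ 1 (m≤m+n n (k * n)))

-- D_k is an induced subgraph of D_(k+1): it is one of the copies.
abstract
  Desc-grow : ∀ {k n} {D : Graph (Fin n)} → Desc k D →
    Σ ℕ λ N → Σ (Graph (Fin N)) λ E → Desc (suc k) E × suc n ≤ N × InducedEmbedding D E
  Desc-grow {k} {n} {D} d = order , realise M , realise-Desc d M , n<order
    , InducedEmbedding-trans {K = realise M} (StepGraph.copy-embedding k D M c₀) (stepGraph↪realise M)
    where
    open Step k D
    open Realisation k D
    M : Matching
    M = enumerationMatching
    n≤sz : n ≤ sz
    n≤sz = n≤k*[n∸1]+1 n (Desc-level-positive d)
    c₀ : Copies
    c₀ = image (λ i → F.inject≤ i n≤sz) , ∣image∣ _ (inject≤-injective n≤sz n≤sz _ _)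
    n<order : suc n ≤ order
    n<order = +-mono-≤ (m≤n+m 1 (k * (n ∸ 1))) (n≤c*n (Inverse.from (proj₂ copies-finite) c₀))
      where
      n≤c*n : ∀ {c} → Fin c → n ≤ c * n
      n≤c*n {suc c} _ = m≤m+n n (c * n)

-- Embedding by induction

room-for-slots : ∀ {m k n} → 2 + m ≤ k → m < n → m + m * n ≤ k * (n ∸ 1) + 1
room-for-slots {m} {k} {suc n} 2+m≤k (s≤s m≤n) = begin
  m + m * suc n     ≡⟨ solve (m List.∷ n List.∷ List.[]) ⟩
  m * n + (m + m)   ≤⟨ +-monoʳ-≤ (m * n) (+-mono-≤ m≤n m≤n) ⟩
  m * n + (n + n)   ≡⟨ solve (m List.∷ n List.∷ List.[]) ⟩
  (2 + m) * n       ≤⟨ *-monoˡ-≤ n 2+m≤k ⟩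
  k * n             ≤⟨ m≤m+n (k * n) 1 ⟩
  k * n + 1         ∎
  where
  open ≤-Reasoning

record DescartesEmbeddingOn {m} (G : Graph (Fin m)) (X : Subset m) : Set where
  field
    level order : ℕ
    host : Graph (Fin order)
    host-Desc : Desc level host
    f : Fin m → Fin order
    f-injective : ∀ {a b} → a ∈ X → b ∈ X → f a ≡ f b → a ≡ b
    f-adj : ∀ {a b} → a ∈ X → b ∈ X → adj G a b ≡ adj host (f a) (f b)

module _ {m} {G : Graph (Fin m)} {X : Subset m} where
  open DescartesEmbeddingOn

  grow : (e : DescartesEmbeddingOn G X) →
    Σ (DescartesEmbeddingOn G X) λ e′ → suc (level e) ≤ level e′ × suc (order e) ≤ order e′
  grow e with Desc-grow (host-Desc e)
  ... | N , E , E-Desc , n<N , (h , h-injective , h-adj) = record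
    { level = suc (level e) ; order = N ; host = E ; host-Desc = E-Desc ; f = h ∘ f e
    ; f-injective = λ pa pb → f-injective e pa pb ∘ h-injective
    ; f-adj = λ pa pb → trans (f-adj e pa pb) (h-adj _ _) } , ≤-refl , n<N

  enlarge : ∀ j (e : DescartesEmbeddingOn G X) →
    Σ (DescartesEmbeddingOn G X) λ e′ → j + level e ≤ level e′ × j + order e ≤ order e′
  enlarge zero e = e , ≤-refl , ≤-refl
  enlarge (suc j) e with enlarge j e
  ... | e₁ , level₁ , order₁ with grow e₁
  ... | e₂ , level₂ , order₂ = e₂ , ≤-trans (s≤s level₁) level₂ , ≤-trans (s≤s order₁) order₂

  roomy : (e : DescartesEmbeddingOn G X) → Σ (DescartesEmbeddingOn G X) λ e′ →
    m < order e′ × m + m * order e′ ≤ Step.sz (level e′) (host e′)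
  roomy e with enlarge (suc m) e
  ... | e′ , level≥ , order≥ = e′ , m<order , room-for-slots 2+m≤level m<order
    where
    m<order : m < order e′
    m<order = ≤-trans (m≤m+n (suc m) (order e)) order≥
    2+m≤level : 2 + m ≤ level e′
    2+m≤level = ≤-trans (subst (_≤ suc m + level e) (+-comm (suc m) 1)
                  (+-monoʳ-≤ (suc m) (Desc-level-positive (host-Desc e)))) level≥

module Extension {m} {G : Graph (Fin m)} (simple : IsSimple G) {X S : Subset m} {label : Fin m → Fin m}
  (κ : Certificates.IsCertificate G X S label) (rest : DescartesEmbeddingOn G (X ─ S))
  (m<n : m < DescartesEmbeddingOn.order rest)
  (room : m + m * DescartesEmbeddingOn.order rest
          ≤ Step.sz (DescartesEmbeddingOn.level rest) (DescartesEmbeddingOn.host rest)) where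

  open Certificates.IsCertificate κ
  open DescartesEmbeddingOn rest using (f) renaming (level to k; order to n; host to D; host-Desc to D-Desc)
  open Step k D
  open Realisation k D

  f-injective : ∀ {a b} → a ∈ X → a ∉ S → b ∈ X → b ∉ S → f a ≡ f b → a ≡ b
  f-injective pa na pb nb =
    DescartesEmbeddingOn.f-injective rest (x∈p∧x∉q⇒x∈p─q pa na) (x∈p∧x∉q⇒x∈p─q pb nb)

  f-adj : ∀ {a b} → a ∈ X → a ∉ S → b ∈ X → b ∉ S → adj G a b ≡ adj D (f a) (f b)
  f-adj pa na pb nb = DescartesEmbeddingOn.f-adj rest (x∈p∧x∉q⇒x∈p─q pa na) (x∈p∧x∉q⇒x∈p─q pb nb)

  adj-sym : ∀ {a b} → adj G a b ≡ true → adj G b a ≡ true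
  adj-sym {a} {b} ab = trans (proj₁ simple b a) ab

  Attached : Fin m → Fin n → Set
  Attached i j = ∃ λ a → ∃ λ s → a ∈ X × a ∉ S × label a ≡ i × f a ≡ j × s ∈ S × adj G a s ≡ true

  attached? : ∀ i j → Dec (Attached i j)
  attached? i j = any? λ a → any? λ s → a ∈? X ×-dec ¬? (a ∈? S) ×-dec label a F.≟ i ×-dec f a F.≟ j
    ×-dec s ∈? S ×-dec adj G a s Bool.≟ true

  abstract
    slots : Fin (m + m * n) ↔ (Fin m ⊎ (Fin m × Fin n))
    slots = ↔-trans +↔⊎ (↔-refl ⊎-↔ *↔×)

    -- The stable set of D_(k+1) has room for a vertex reserved for each s ∈ S and
    -- a spare vertex for each position j of the copy assigned to each label i.
    slot : Fin m ⊎ (Fin m × Fin n) → Fin sz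
    slot x = F.inject≤ (Inverse.from slots x) room

    slot-injective : Injective _≡_ _≡_ slot
    slot-injective {x} {y} e = trans (sym (strictlyInverseˡ x))
      (trans (cong to (inject≤-injective room room (from x) (from y) e)) (strictlyInverseˡ y))
      where open Inverse slots using (to; from; strictlyInverseˡ)

    reserved : Fin m → Fin sz
    reserved s = slot (inj₁ s)

    spare : Fin m → Fin n → Fin sz
    spare i j = slot (inj₂ (i , j))

    reserved-injective : ∀ {s s′} → reserved s ≡ reserved s′ → s ≡ s′
    reserved-injective {s} {s′} e = inj₁-injective (slot-injective {inj₁ s} {inj₁ s′} e)

    spare-injective : ∀ {i j i′ j′} → spare i j ≡ spare i′ j′ → (i , j) ≡ (i′ , j′)
    spare-injective {i} {j} {i′} {j′} e =
      inj₂-injective (slot-injective {inj₂ (i , j)} {inj₂ (i′ , j′)} e)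

    reserved≢spare : ∀ {s i j} → reserved s ≢ spare i j
    reserved≢spare {s} {i} {j} e with slot-injective {inj₁ s} {inj₂ (i , j)} e
    ... | ()

    attach : ∀ i j → Dec (Attached i j) → Fin sz
    attach i j (yes (_ , s , _)) = reserved s
    attach i j (no _) = spare i j

    -- Position j of the copy for label i is matched to the S-neighbour of the vertex placed there, if any.
    matching : Fin m → Fin n → Fin sz
    matching i j = attach i j (attached? i j)

    attach-injective : ∀ i {j j′} d d′ → attach i j d ≡ attach i j′ d′ → j ≡ j′
    attach-injective i (yes (a , s , pa , na , refl , refl , ps , as))
                       (yes (a′ , s′ , pa′ , na′ , la′ , refl , ps′ , as′)) e
      with reserved-injective e
    ... | refl = cong f (one-per-label s a a′ ps pa na pa′ na′ (sym la′) (adj-sym as) (adj-sym as′))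
    attach-injective i (yes _) (no _) e = ⊥-elim (reserved≢spare e)
    attach-injective i (no _) (yes _) e = ⊥-elim (reserved≢spare (sym e))
    attach-injective i (no _) (no _) e with spare-injective e
    ... | refl = refl

    matching-injective : ∀ i → Injective _≡_ _≡_ (matching i)
    matching-injective i = attach-injective i (attached? i _) (attached? i _)

    copyFor : Fin m → Copies
    copyFor i = image (matching i) , ∣image∣ (matching i) (matching-injective i)

    -- A label covers at most m < n positions, so its copy contains a spare vertex.
    unattached : ∀ i → ∃ λ j → ¬ Attached i j
    unattached i = ¬∀⟶∃¬ n (Attached i) (attached? i) λ all → <⇒≱ m<n (injective⇒≤ {f = proj₁ ∘ all}
      λ {j} {j′} e → trans (sym (attached-position (all j)))
                       (trans (cong f e) (attached-position (all j′))))
      where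
      attached-position : ∀ {j} (att : Attached i j) → f (proj₁ att) ≡ j
      attached-position (_ , _ , _ , _ , _ , fa≡j , _) = fa≡j

    attach-unattached : ∀ {i j} (d : Dec (Attached i j)) → ¬ Attached i j → attach i j d ≡ spare i j
    attach-unattached (yes att) ¬att = ⊥-elim (¬att att)
    attach-unattached (no _) _ = refl

    attach≡spare : ∀ {i i′ j j′} (d : Dec (Attached i′ j′)) → attach i′ j′ d ≡ spare i j → i′ ≡ i
    attach≡spare (yes _) e = ⊥-elim (reserved≢spare e)
    attach≡spare (no _) e with spare-injective e
    ... | refl = refl

    copyFor-injective : ∀ {i i′} → proj₁ (copyFor i) ≡ proj₁ (copyFor i′) → i ≡ i′
    copyFor-injective {i} {i′} eq with unattached i
    ... | j₀ , ¬att with image-onto (matching i′) (subst (spare i j₀ ∈_) eq spare∈copyFor-i)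
      where
      spare∈copyFor-i : spare i j₀ ∈ image (matching i)
      spare∈copyFor-i = subst (_∈ image (matching i)) (attach-unattached (attached? i j₀) ¬att) (∈-image _ j₀)
    ... | j′ , e′ = sym (attach≡spare (attached? i′ j′) e′)

    Designated : Copies → Set
    Designated c = ∃ λ i → proj₁ c ≡ proj₁ (copyFor i)

    designated? : ∀ c → Dec (Designated c)
    designated? c = any? λ i → ≡-dec Bool._≟_ (proj₁ c) (proj₁ (copyFor i))

    module Enum = Matching enumerationMatching

    μ-by : ∀ c → Dec (Designated c) → Fin n → Fin sz
    μ-by c (yes (i , _)) = matching i
    μ-by c (no _) = Enum.μ c

    M : Matching
    M = record
      { μ = λ c → μ-by c (designated? c)
      ; inj = λ c → inj-by c (designated? c)
      ; into = λ c → into-by c (designated? c)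
      ; onto = λ c → onto-by c (designated? c)
      }
      where
      inj-by : ∀ c d {v w} → μ-by c d v ≡ μ-by c d w → v ≡ w
      inj-by c (yes (i , _)) = matching-injective i
      inj-by c (no _) = Enum.inj c
      into-by : ∀ c d v → μ-by c d v ∈ proj₁ c
      into-by c (yes (i , eq)) v = subst (matching i v ∈_) (sym eq) (∈-image _ v)
      into-by c (no _) = Enum.into c
      onto-by : ∀ c d t → t ∈ proj₁ c → ∃ λ v → μ-by c d v ≡ t
      onto-by c (yes (i , eq)) t t∈c = image-onto (matching i) (subst (t ∈_) eq t∈c)
      onto-by c (no _) = Enum.onto c

    μ-copyFor : ∀ i v → Matching.μ M (copyFor i) v ≡ matching i v
    μ-copyFor i v = μ-by-copyFor (designated? (copyFor i))
      where
      μ-by-copyFor : ∀ d → μ-by (copyFor i) d v ≡ matching i v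
      μ-by-copyFor (yes (i′ , eq)) = cong (λ z → matching z v) (sym (copyFor-injective eq))
      μ-by-copyFor (no ¬designated) = ⊥-elim (¬designated (i , refl))

    attach-neighbour : ∀ {a s} → a ∈ X → a ∉ S → s ∈ S → (d : Dec (Attached (label a) (f a))) →
      adj G a s ≡ true → attach (label a) (f a) d ≡ reserved s
    attach-neighbour pa na ps (no ¬att) as = ⊥-elim (¬att (_ , _ , pa , na , refl , refl , ps , as))
    attach-neighbour pa na ps (yes (a′ , s′ , pa′ , na′ , _ , fa′≡fa , ps′ , a′s′)) as
      with f-injective pa′ na′ pa na fa′≡fa
    ... | refl = cong reserved (one-in-S a′ s′ _ pa na ps′ ps a′s′ as)

    neighbour-attach : ∀ {a s} → a ∈ X → a ∉ S → (d : Dec (Attached (label a) (f a))) →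
      attach (label a) (f a) d ≡ reserved s → adj G a s ≡ true
    neighbour-attach _ _ (no _) e = ⊥-elim (reserved≢spare (sym e))
    neighbour-attach pa na (yes (a′ , s′ , pa′ , na′ , _ , fa′≡fa , _ , a′s′)) e
      with f-injective pa′ na′ pa na fa′≡fa | reserved-injective e
    ... | refl | refl = a′s′

    adj-attached : ∀ {s a} → s ∈ S → a ∈ X → a ∉ S →
      adj G s a ≡ ⌊ matching (label a) (f a) F.≟ reserved s ⌋
    adj-attached {s} {a} ps pa na = ≡⌊⌋ (matching (label a) (f a) F.≟ reserved s)
      (attach-neighbour pa na ps (attached? (label a) (f a)) ∘ adj-sym)
      (adj-sym ∘ neighbour-attach pa na (attached? (label a) (f a)))

  place : ∀ x → Dec (x ∈ S) → StepV
  place x (yes _) = inj₁ (reserved x)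
  place x (no _) = inj₂ (copyFor (label x) , f x)

  place-injective : ∀ {x y} → x ∈ X → y ∈ X → ∀ dx dy → place x dx ≡ place y dy → x ≡ y
  place-injective _ _ (yes _) (yes _) e = reserved-injective (inj₁-injective e)
  place-injective px py (no nx) (no ny) e = f-injective px nx py ny (cong proj₂ (inj₂-injective e))

  place-adj : ∀ {x y} → x ∈ X → y ∈ X → ∀ dx dy →
    adj G x y ≡ adj (stepGraph M) (place x dx) (place y dy)
  place-adj {x} {y} _ _ (yes sx) (yes sy) = S-stable x y sx sy
  place-adj {x} {y} _ py (yes sx) (no ny) rewrite μ-copyFor (label y) (f y) = adj-attached sx py ny
  place-adj {x} {y} px _ (no nx) (yes sy) rewrite μ-copyFor (label x) (f x) =
    trans (proj₁ simple x y) (adj-attached sy px nx)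
  place-adj {x} {y} px py (no nx) (no ny) rewrite sym (f-adj px nx py ny) =
    ≡⌊⌋∧ (≡-dec Bool._≟_ _ _) (cong (proj₁ ∘ copyFor) ∘ label-edge x y px nx py ny)

  extension : DescartesEmbeddingOn G X
  extension with stepGraph↪realise M
  ... | h , h-injective , h-adj = record
    { level = suc k ; order = order ; host = realise M ; host-Desc = realise-Desc D-Desc M
    ; f = h ∘ g
    ; f-injective = λ {a} {b} pa pb → place-injective pa pb (a ∈? S) (b ∈? S) ∘ h-injective {g a} {g b}
    ; f-adj = λ {a} {b} pa pb → trans (place-adj pa pb (a ∈? S) (b ∈? S)) (h-adj (g a) (g b))
    }
    where
    g : Fin m → StepV
    g x = place x (x ∈? S)

module _ {m} {G : Graph (Fin m)} (simple : IsSimple G) (splittable : InducedSplittable G) where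
  open Certificates G

  descartesEmbeddingOn : ∀ X → Acc _⊂_ X → DescartesEmbeddingOn G X
  descartesEmbeddingOn X (acc smaller) with nonempty? X
  ... | no empty = record
    { level = 1 ; order = 1 ; host = mkGraph (λ _ _ → false) ; host-Desc = one _ refl ; f = λ _ → F.zero
    ; f-injective = λ pa _ _ → ⊥-elim (empty (_ , pa)) ; f-adj = λ pa _ → ⊥-elim (empty (_ , pa)) }
  ... | yes nonempty with splittable⇒certificate simple splittable X nonempty
  ... | S , _ , κ with roomy (descartesEmbeddingOn (X ─ S) (smaller (p∩q≢∅⇒p─q⊂p X S X∩S-nonempty)))
    where
    open IsCertificate κ
    X∩S-nonempty : Nonempty (X ∩ S)
    X∩S-nonempty = let (s , s∈S) = S-nonempty in s , x∈p∩q⁺ (S⊆X s s∈S , s∈S)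
  ... | rest , m<n , room = Extension.extension simple κ rest m<n room

inducedSplittable⇒BlancheDescartes : ∀ {m} {G : Graph (Fin m)} → IsSimple G → InducedSplittable G →
  BlancheDescartes G
inducedSplittable⇒BlancheDescartes simple splittable =
  level , order , host , host-Desc , f , f-injective ∈⊤ ∈⊤ , λ _ _ → f-adj ∈⊤ ∈⊤
  where open DescartesEmbeddingOn (descartesEmbeddingOn simple splittable Data.Fin.Subset.⊤ (⊂-wellFounded _))

theorem10 : (n : ℕ) (G : Graph (Fin (suc n))) → IsSimple G →
    BlancheDescartes G ⇔
      ((X : Subset (suc n)) → Nonempty X →
        Σ (Pred (Σ (Fin (suc n)) (λ v → v ∈ X)) 0ℓ) λ S →
          (∃ λ v → S v) × Stable (G [ X ]) S × StronglySplitting (G [ X ]) S)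
theorem10 n G simple = mk⇔ BlancheDescartes⇒inducedSplittable (inducedSplittable⇒BlancheDescartes simple)
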